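{- Let $n\ge 3$ and $j\in\{1,\dots,n-1\}$. Let $\mathcal{D}_{n,j}$ be the set of derangements $\sigma$ of $[n]$ with $\sigma(n)=j$. Define $U_{n,j}=\{23\cdots n1\}$ (the single $n$-cycle $(1,2,\dots,n)$) if $j=1$, and $U_{n,j}=\{\sigma\in\mathcal{D}_{n,j}:\sigma(2)=1,\ \sigma(1)\ne 2\}$ if $j\ge 2$. Let $E_{n,j}=\mathcal{D}_{n,j}\setminus U_{n,j}$. For $\sigma\in E_{n,j}$ let $i_\sigma$ be the smallest integer $i$ such that $\sigma(i)\neq i+1$, and let $\varphi(\sigma)=(\sigma(i_\sigma),\sigma(i_\sigma+1))\circ\sigma$, i.e. the permutation obtained from $\sigma$ by exchanging the values at positions $i_\sigma$ and $i_\sigma+1$. Then $\varphi$ is an involution on $E_{n,j}$ (it maps $E_{n,j}$ into itself and $\varphi(\varphi(\sigma))=\sigma$), and for every $\sigma\in E_{n,j}$ one has $\mathrm{RLMv}(\varphi(\sigma))=\mathrm{RLMv}(\sigma)$, $\mathrm{EXCv}(\varphi(\sigma))=\mathrm{EXCv}(\sigma)$ and $(-1)^{\mathrm{cyc}(\varphi(\sigma))}=-(-1)^{\mathrm{cyc}(\sigma)}$. Equivalently, $w_{\varphi(\sigma)}=-w_\sigma$ where $w_\sigma=(-1)^{\mathrm{cyc}(\sigma)}\prod_{i\in\mathrm{RLMv}(\sigma)}x_i\prod_{i\in\mathrm{EXCv}(\sigma)}y_i$.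
   Context: A derangement of $[n]$ is a permutation with no fixed points. For a permutation $\sigma$ of $[n]$, $\mathrm{cyc}(\sigma)$ is its number of cycles; $\mathrm{EXCv}(\sigma)=\{\sigma(i):\sigma(i)>i\}$ is the set of excedance values; $\mathrm{RLMv}(\sigma)=\{\sigma(i):\sigma(i)<\sigma(k)\text{ for all }k>i\}$ is the set of right-to-left minimum values. Compositions are read right to left, and $(a,b)$ denotes the transposition exchanging $a$ and $b$. -}

module Defs where

open import Data.Nat using (ℕ; zero; suc; _<_; _≤_; _≤ᵇ_)
open import Data.Fin using (Fin; toℕ; inject₁) renaming (zero to fzero; suc to fsuc; _<_ to _<ᶠ_)
open import Data.Fin.Permutation using (Permutation′; _⟨$⟩ʳ_; transpose; _∘ₚ_)
open import Data.Bool using (Bool; true; false; if_then_else_; not; _∧_)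
open import Data.Maybe using (Maybe; just; nothing)
import Data.Maybe as Maybe
open import Data.List using (List; allFin; upTo; map; foldr)
open import Data.Nat.ListAction using (sum)
open import Data.Product using (_×_; ∃)
open import Data.Sum using (_⊎_)
open import Relation.Nullary using (¬_; does)
open import Relation.Binary.PropositionalEquality using (_≡_; _≢_)
open import Data.Nat.Properties using (_≟_)

-- Conventions: [n] is modelled by Fin n, the element i : Fin n standing
-- for the integer  val i = toℕ i + 1 ∈ {1,…,n}.

Perm : ℕ → Set
Perm n = Permutation′ n

val : ∀ {n} → Fin n → ℕ
val i = suc (toℕ i)

ValAt : ∀ {n} → Perm n → ℕ → ℕ → Set
ValAt σ p v = ∀ i → val i ≡ p → val (σ ⟨$⟩ʳ i) ≡ v

IsDerangement : ∀ {n} → Perm n → Set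
IsDerangement σ = ∀ i → σ ⟨$⟩ʳ i ≢ i

D : (n j : ℕ) → Perm n → Set
D n j σ = IsDerangement σ × ValAt σ n j

IsLongCycle : ∀ {n} → Perm n → Set
IsLongCycle {n} σ = ∀ i → (val i < n → val (σ ⟨$⟩ʳ i) ≡ suc (val i))
                        × (val i ≡ n → val (σ ⟨$⟩ʳ i) ≡ 1)

U : (n j : ℕ) → Perm n → Set
U n j σ = (j ≡ 1 × IsLongCycle σ)
        ⊎ (2 ≤ j × D n j σ × ValAt σ 2 1 × ¬ ValAt σ 1 2)

E : (n j : ℕ) → Perm n → Set
E n j σ = D n j σ × ¬ U n j σ

firstFin : ∀ {m} → (Fin m → Bool) → Maybe (Fin m)
firstFin {zero}  p = nothing
firstFin {suc m} p = if p fzero then just fzero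
                     else Maybe.map fsuc (firstFin (λ k → p (fsuc k)))

-- i_σ : the smallest position i ∈ {1,…,n-1} with σ(i) ≠ i+1, returned as
-- k : Fin m (n = suc m) with i = val k; position i is  inject₁ k  and
-- position i+1 is  fsuc k.  (nothing if no such i < n exists.)
iσ : ∀ {m} → Perm (suc m) → Maybe (Fin m)
iσ σ = firstFin (λ k → not (does (toℕ (σ ⟨$⟩ʳ inject₁ k) ≟ suc (toℕ k))))

-- φ(σ) = (σ(i_σ), σ(i_σ+1)) ∘ σ : exchange the values at positions i_σ and
-- i_σ+1 (identity default when i_σ is undefined, which never happens on E).
-- (transpose a b ∘ₚ σ) maps k to σ(swap_{a,b}(k)).
φ : ∀ {n} → Perm n → Perm n
φ {zero}  σ = σ
φ {suc m} σ with iσ σ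
... | just k  = transpose (inject₁ k) (fsuc k) ∘ₚ σ
... | nothing = σ

iter : ∀ {n} → Perm n → ℕ → Fin n → Fin n
iter σ zero    i = i
iter σ (suc k) i = σ ⟨$⟩ʳ iter σ k i

-- i is the minimum of its cycle: i ≤ σ^k(i) for all k < n
-- (the cycle of i is {σ^k(i) : k < n})
isCycleMin : ∀ {n} → Perm n → Fin n → Bool
isCycleMin {n} σ i = foldr (λ k b → (toℕ i ≤ᵇ toℕ (iter σ k i)) ∧ b) true (upTo n)

-- cyc(σ): number of cycles = number of cycle minima
cyc : ∀ {n} → Perm n → ℕ
cyc {n} σ = sum (map (λ i → if isCycleMin σ i then 1 else 0) (allFin n))

InEXCv : ∀ {n} → Perm n → Fin n → Set
InEXCv σ v = ∃ λ i → σ ⟨$⟩ʳ i ≡ v × i <ᶠ σ ⟨$⟩ʳ i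

InRLMv : ∀ {n} → Perm n → Fin n → Set
InRLMv σ v = ∃ λ i → σ ⟨$⟩ʳ i ≡ v × (∀ k → i <ᶠ k → v <ᶠ σ ⟨$⟩ʳ k)

{-# OPTIONS --safe #-}

-- Composing with a transposition
-- merges the cycles through i and i+1 if they differ and splits their common cycle otherwise, so
-- cyc changes by exactly one; cyc counts cycle minima, and a merge loses exactly the larger of the
-- two former minima. As σ(t) = t+1 for t < i, the values at i and i+1 are 1 or exceed i+1
-- (σ(i) ≠ i+1 by the choice of i, σ(i+1) ≠ i+1 as σ is a derangement). This keeps φ(σ) in E_{n,j}
-- with the same i_σ, hence φ is an involution, and it makes the exchange invisible to EXCv and to
-- RLMv: a right-to-left minimum at position i+1 must be the value 1.

module Submission where

open import Defs
open import Data.Bool using (Bool; true; false; T; not; if_then_else_; _∧_)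
open import Data.Bool.ListAction using (all)
open import Data.Bool.Properties using (⇔→≡; T-≡; ¬-not)
open import Data.Empty using (⊥-elim)
open import Data.Fin as F using (Fin; toℕ; fromℕ<; inject₁; lower₁)
open import Data.Fin.Permutation using (_⟨$⟩ʳ_; _⟨$⟩ˡ_; inverseˡ; inverseʳ)
import Data.Fin.Permutation.Components as PC
open import Data.Fin.Properties
  using ( toℕ-injective; toℕ<n; toℕ-fromℕ; toℕ-fromℕ<; toℕ-inject; toℕ-inject₁; toℕ-lower₁
        ; inject₁-lower₁; pigeonhole; any?; ¬∀⟶∃¬-smallest )
import Data.Fin.Properties as Finₚ
open import Data.Integer using (-1ℤ; _^_; -_)
open import Data.Integer.Properties using (-1*i≡-i; neg-involutive)
open import Data.List using (upTo; tabulate)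
open import Data.List.Membership.Propositional.Properties using (∈-upTo⁺)
open import Data.List.Properties using (foldr-map; map-tabulate; tabulate-cong)
import Data.List.Relation.Unary.All as All
open import Data.List.Relation.Unary.All.Properties using (all⁺; all⁻)
open import Data.Maybe using (just; nothing)
open import Data.Nat as ℕ using (ℕ; zero; suc; _+_; _*_; _≤_; _<_; z≤n; s≤s)
open import Data.Nat.DivMod using (_%_; _/_; m≡m%n+[m/n]*n; m%n<n)
open import Data.Nat.ListAction using (sum)
open import Data.Nat.Properties
open import Data.Product using (∃; _×_; _,_; proj₁; proj₂)
open import Data.Sum as Sum using (_⊎_; inj₁; inj₂; [_,_])
open import Function using (_∘_; _⇔_; mk⇔; Equivalence)
import Function.Properties.Equivalence as ⇔
open import Relation.Binary.Definitions using (tri<; tri≈; tri>)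
open import Relation.Binary.PropositionalEquality
  using (_≡_; _≢_; refl; sym; trans; cong; cong₂; subst; subst₂; module ≡-Reasoning)
open import Relation.Nullary using (¬_; Dec; yes; no; ¬?; does; _×-dec_)
open import Relation.Nullary.Decidable using (decidable-stable; map′; dec-true; dec-false)
open import Relation.Unary using (Decidable)

least-witness : ∀ {P : ℕ → Set} → Decidable P → ∀ {t} → P t →
                ∃ λ t₀ → P t₀ × (∀ {u} → u < t₀ → ¬ P u)
least-witness {P} P? {t} Pt
  with ¬∀⟶∃¬-smallest (suc t) (λ i → ¬ P (toℕ i)) (λ i → ¬? (P? (toℕ i)))
                      (λ h → h (F.fromℕ t) (subst P (sym (toℕ-fromℕ t)) Pt))
... | i , ¬¬Pi , below = toℕ i , decidable-stable (P? (toℕ i)) ¬¬Pi , earlier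
  where
  earlier : ∀ {u} → u < toℕ i → ¬ P u
  earlier u<i Pu = below (fromℕ< u<i) (subst P (sym (trans (toℕ-inject _) (toℕ-fromℕ< u<i))) Pu)

SameCycle : ∀ {n} → Perm n → Fin n → Fin n → Set
SameCycle σ x y = ∃ λ k → iter σ k x ≡ y

IsCycleLeast : ∀ {n} → Perm n → Fin n → Set
IsCycleLeast σ x = ∀ y → SameCycle σ x y → toℕ x ≤ toℕ y

module Cycles {n : ℕ} (σ : Perm n) where

  ⟨$⟩ʳ-injective : ∀ {x y} → σ ⟨$⟩ʳ x ≡ σ ⟨$⟩ʳ y → x ≡ y
  ⟨$⟩ʳ-injective eq = trans (sym (inverseˡ σ)) (trans (cong (σ ⟨$⟩ˡ_) eq) (inverseˡ σ))

  iter-+ : ∀ a b x → iter σ (a + b) x ≡ iter σ a (iter σ b x)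
  iter-+ zero    b x = refl
  iter-+ (suc a) b x = cong (σ ⟨$⟩ʳ_) (iter-+ a b x)

  iter-injective : ∀ k {x y} → iter σ k x ≡ iter σ k y → x ≡ y
  iter-injective zero    eq = eq
  iter-injective (suc k) eq = iter-injective k (⟨$⟩ʳ-injective eq)

  iter-period : ∀ x → ∃ λ d → d < n × iter σ (suc d) x ≡ x
  iter-period x with pigeonhole (n<1+n n) (λ (t : Fin (suc n)) → iter σ (toℕ t) x)
  ... | i , j , i<j , eq with m≤n⇒∃[o]m+o≡n i<j
  ... | d , i+1+d≡j = d , d<n , iter-injective (toℕ i) returns
    where
    open ≡-Reasoning
    d<n : d < n
    d<n = ≤-trans (s≤s (m≤n+m d (toℕ i))) (≤-pred (subst (_< suc n) (sym i+1+d≡j) (toℕ<n j)))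
    returns : iter σ (toℕ i) (iter σ (suc d) x) ≡ iter σ (toℕ i) x
    returns = begin
      iter σ (toℕ i) (iter σ (suc d) x) ≡⟨ iter-+ (toℕ i) (suc d) x ⟨
      iter σ (toℕ i + suc d) x          ≡⟨ cong (λ t → iter σ t x) (trans (+-suc (toℕ i) d) i+1+d≡j) ⟩
      iter σ (toℕ j) x                  ≡⟨ eq ⟨
      iter σ (toℕ i) x                  ∎

  iter-multiple : ∀ {d x} → iter σ (suc d) x ≡ x → ∀ c → iter σ (c * suc d) x ≡ x
  iter-multiple per zero    = refl
  iter-multiple {d} {x} per (suc c) =
    trans (iter-+ (suc d) (c * suc d) x) (trans (cong (iter σ (suc d)) (iter-multiple per c)) per)

  sameCycle-refl : ∀ {x} → SameCycle σ x x
  sameCycle-refl = 0 , refl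

  sameCycle-trans : ∀ {x y z} → SameCycle σ x y → SameCycle σ y z → SameCycle σ x z
  sameCycle-trans (a , refl) (b , refl) = b + a , iter-+ b a _

  sameCycle-step : ∀ {x y} → SameCycle σ x y → SameCycle σ x (σ ⟨$⟩ʳ y)
  sameCycle-step (a , refl) = suc a , refl

  sameCycle-sym : ∀ {x y} → SameCycle σ x y → SameCycle σ y x
  sameCycle-sym {x} (k , refl) with iter-period x
  ... | d , _ , per = k * d , (begin
      iter σ (k * d) (iter σ k x) ≡⟨ iter-+ (k * d) k x ⟨
      iter σ (k * d + k) x        ≡⟨ cong (λ t → iter σ t x) (trans (+-comm (k * d) k) (sym (*-suc k d))) ⟩
      iter σ (k * suc d) x        ≡⟨ iter-multiple per k ⟩
      x                           ∎)
    where open ≡-Reasoning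

  sameCycle-bounded : ∀ {x y} → SameCycle σ x y → ∃ λ k → k < n × iter σ k x ≡ y
  sameCycle-bounded {x} (k , refl) with iter-period x
  ... | d , d<n , per = k % suc d , <-≤-trans (m%n<n k (suc d)) d<n , sym (begin
      iter σ k x                                          ≡⟨ cong (λ t → iter σ t x) (m≡m%n+[m/n]*n k (suc d)) ⟩
      iter σ (k % suc d + k / suc d * suc d) x            ≡⟨ iter-+ (k % suc d) _ x ⟩
      iter σ (k % suc d) (iter σ (k / suc d * suc d) x)   ≡⟨ cong (iter σ (k % suc d)) (iter-multiple per (k / suc d)) ⟩
      iter σ (k % suc d) x                                ∎)
    where open ≡-Reasoning

  sameCycle? : ∀ x y → Dec (SameCycle σ x y)
  sameCycle? x y = map′ (λ (i , eq) → toℕ i , eq) bounded (any? λ i → iter σ (toℕ i) x F.≟ y)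
    where
    bounded : SameCycle σ x y → ∃ λ (i : Fin n) → iter σ (toℕ i) x ≡ y
    bounded r with sameCycle-bounded r
    ... | k , k<n , eq = fromℕ< k<n , trans (cong (λ t → iter σ t x) (toℕ-fromℕ< k<n)) eq

  sameCycle-closed : (S : Fin n → Set) → (∀ z → S z → S (σ ⟨$⟩ʳ z)) →
                     ∀ {x y} → S x → SameCycle σ x y → S y
  sameCycle-closed S closed Sx (zero  , refl) = Sx
  sameCycle-closed S closed Sx (suc k , refl) = closed _ (sameCycle-closed S closed Sx (k , refl))

  T-isCycleMin⇔ : ∀ x → T (isCycleMin σ x) ⇔ IsCycleLeast σ x
  T-isCycleMin⇔ x = mk⇔ to from
    where
    test : ℕ → Bool
    test k = toℕ x ℕ.≤ᵇ toℕ (iter σ k x)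
    isCycleMin≡all : isCycleMin σ x ≡ all test (upTo n)
    isCycleMin≡all = sym (foldr-map _∧_ test true (upTo n))
    to : T (isCycleMin σ x) → IsCycleLeast σ x
    to t y r with sameCycle-bounded r
    ... | k , k<n , refl = ≤ᵇ⇒≤ _ _ (All.lookup (all⁺ test (upTo n) (subst T isCycleMin≡all t)) (∈-upTo⁺ k<n))
    from : IsCycleLeast σ x → T (isCycleMin σ x)
    from least = subst T (sym isCycleMin≡all)
                   (all⁻ test {upTo n} (All.tabulate λ {k} _ → ≤⇒≤ᵇ (least _ (k , refl))))

  cycleLeast-unique : ∀ {a b} → IsCycleLeast σ a → IsCycleLeast σ b → SameCycle σ a b → a ≡ b
  cycleLeast-unique la lb r = toℕ-injective (≤-antisym (la _ r) (lb _ (sameCycle-sym r)))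

  cycleLeast-exists : ∀ x → ∃ λ m → SameCycle σ x m × IsCycleLeast σ m
  cycleLeast-exists x with least-witness value? {toℕ x} (x , refl , sameCycle-refl)
    where
    value? : Decidable (λ v → ∃ λ y → toℕ y ≡ v × SameCycle σ x y)
    value? v = any? λ y → (toℕ y ℕ.≟ v) ×-dec sameCycle? x y
  ... | _ , (m , refl , xm) , below = m , xm , least
    where
    least : IsCycleLeast σ m
    least y my with toℕ m ℕ.≤? toℕ y
    ... | yes m≤y = m≤y
    ... | no m≰y  = ⊥-elim (below (≰⇒> m≰y) (y , refl , sameCycle-trans xm my))

sum-tabulate-bumped : ∀ {n} (f g : Fin n → ℕ) (M : Fin n) →
                    (∀ x → x ≢ M → g x ≡ f x) → g M ≡ suc (f M) →
                    sum (tabulate g) ≡ suc (sum (tabulate f))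
sum-tabulate-bumped {suc n} f g F.zero same bump =
  cong₂ _+_ bump (cong sum (tabulate-cong λ x → same (F.suc x) λ ()))
sum-tabulate-bumped {suc n} f g (F.suc M) same bump = begin
  g F.zero + sum (tabulate (g ∘ F.suc))      ≡⟨ cong₂ _+_ (same F.zero λ ()) (sum-tabulate-bumped (f ∘ F.suc) (g ∘ F.suc) M
                                                  (λ x x≢M → same (F.suc x) (x≢M ∘ Finₚ.suc-injective)) bump) ⟩
  f F.zero + suc (sum (tabulate (f ∘ F.suc))) ≡⟨ +-suc _ _ ⟩
  suc (f F.zero + sum (tabulate (f ∘ F.suc))) ∎
  where open ≡-Reasoning

isCycleMin-cong : ∀ {n} {τ ρ : Perm n} {x} → (IsCycleLeast τ x ⇔ IsCycleLeast ρ x) →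
                  isCycleMin τ x ≡ isCycleMin ρ x
isCycleMin-cong {τ = τ} {ρ} {x} τ⇔ρ =
  ⇔→≡ (⇔.trans (⇔.sym T-≡) (⇔.trans (Cycles.T-isCycleMin⇔ τ x)
        (⇔.trans τ⇔ρ (⇔.trans (⇔.sym (Cycles.T-isCycleMin⇔ ρ x)) T-≡))))

cyc-loses-one-minimum : ∀ {n} (τ ρ : Perm n) (M : Fin n) →
           (∀ x → x ≢ M → IsCycleLeast τ x ⇔ IsCycleLeast ρ x) →
           IsCycleLeast τ M → ¬ IsCycleLeast ρ M → cyc τ ≡ suc (cyc ρ)
cyc-loses-one-minimum τ ρ M agree least-τ ¬least-ρ = begin
  cyc τ                               ≡⟨ cong sum (map-tabulate (λ x → x) (indicator τ)) ⟩
  sum (tabulate (indicator τ))        ≡⟨ sum-tabulate-bumped (indicator ρ) (indicator τ) M same bump ⟩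
  suc (sum (tabulate (indicator ρ)))  ≡⟨ cong (suc ∘ sum) (map-tabulate (λ x → x) (indicator ρ)) ⟨
  suc (cyc ρ)                         ∎
  where
  open ≡-Reasoning
  indicator : Perm _ → Fin _ → ℕ
  indicator σ x = if isCycleMin σ x then 1 else 0
  same : ∀ x → x ≢ M → indicator τ x ≡ indicator ρ x
  same x x≢M = cong (if_then 1 else 0) (isCycleMin-cong (agree x x≢M))
  M-minimal-in-τ : isCycleMin τ M ≡ true
  M-minimal-in-τ = Equivalence.to T-≡ (Equivalence.from (Cycles.T-isCycleMin⇔ τ M) least-τ)
  M-not-minimal-in-ρ : isCycleMin ρ M ≡ false
  M-not-minimal-in-ρ = ¬-not (¬least-ρ ∘ Equivalence.to (Cycles.T-isCycleMin⇔ ρ M) ∘ Equivalence.from T-≡)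
  bump : indicator τ M ≡ suc (indicator ρ M)
  bump rewrite M-minimal-in-τ | M-not-minimal-in-ρ = refl

record ExchangedAt {n} (τ ρ : Perm n) (p q : Fin n) : Set where
  field
    p≢q       : p ≢ q
    at-p      : ρ ⟨$⟩ʳ p ≡ τ ⟨$⟩ʳ q
    at-q      : ρ ⟨$⟩ʳ q ≡ τ ⟨$⟩ʳ p
    elsewhere : ∀ x → x ≢ p → x ≢ q → ρ ⟨$⟩ʳ x ≡ τ ⟨$⟩ʳ x

module _ {n} {τ ρ : Perm n} {p q : Fin n} (ex : ExchangedAt τ ρ p q) where
  open ExchangedAt ex

  exchangedAt-sym : ExchangedAt ρ τ p q
  exchangedAt-sym = record
    { p≢q = p≢q ; at-p = sym at-q ; at-q = sym at-p ; elsewhere = λ x x≢p x≢q → sym (elsewhere x x≢p x≢q) }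

  exchangedAt-swap : ExchangedAt τ ρ q p
  exchangedAt-swap = record
    { p≢q = p≢q ∘ sym ; at-p = at-q ; at-q = at-p ; elsewhere = λ x x≢q x≢p → elsewhere x x≢p x≢q }

  exchangedAt-involutive : ∀ {ρ′} → ExchangedAt ρ ρ′ p q → ∀ x → ρ′ ⟨$⟩ʳ x ≡ τ ⟨$⟩ʳ x
  exchangedAt-involutive ex′ x with x F.≟ p | x F.≟ q
  ... | yes refl | _        = trans (ExchangedAt.at-p ex′) at-q
  ... | no _     | yes refl = trans (ExchangedAt.at-q ex′) at-p
  ... | no x≢p   | no x≢q   = trans (ExchangedAt.elsewhere ex′ x x≢p x≢q) (elsewhere x x≢p x≢q)

module Merge {n} {τ ρ : Perm n} {p q : Fin n} (ex : ExchangedAt τ ρ p q) (p≁q : ¬ SameCycle τ p q) where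
  open ExchangedAt ex
  private
    module τ = Cycles τ
    module ρ = Cycles ρ

  ρ-follows-cycle-of-q : ∀ t → SameCycle ρ p q ⊎ iter ρ (suc t) p ≡ iter τ t (τ ⟨$⟩ʳ q)
  ρ-follows-cycle-of-q zero = inj₂ at-p
  ρ-follows-cycle-of-q (suc t) with ρ-follows-cycle-of-q t
  ... | inj₁ p∼q = inj₁ p∼q
  ... | inj₂ eq with iter τ t (τ ⟨$⟩ʳ q) F.≟ q
  ...   | yes hit  = inj₁ (suc t , trans eq hit)
  ...   | no  miss = inj₂ (trans (cong (ρ ⟨$⟩ʳ_) eq) (elsewhere _ ≢p miss))
    where
    ≢p : iter τ t (τ ⟨$⟩ʳ q) ≢ p
    ≢p e = p≁q (τ.sameCycle-sym (τ.sameCycle-trans (1 , refl) (t , e)))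

  p∼ρq : SameCycle ρ p q
  p∼ρq with τ.sameCycle-sym (τ.sameCycle-step (τ.sameCycle-refl {q}))
  ... | t , back with ρ-follows-cycle-of-q t
  ...   | inj₁ p∼q = p∼q
  ...   | inj₂ eq  = suc t , trans eq back

  τ-step-within-ρ-cycle : ∀ z → SameCycle ρ z (τ ⟨$⟩ʳ z)
  τ-step-within-ρ-cycle z with z F.≟ p | z F.≟ q
  ... | yes refl | _        = subst (SameCycle ρ z) at-q (ρ.sameCycle-step p∼ρq)
  ... | no _     | yes refl = subst (SameCycle ρ z) at-p (ρ.sameCycle-step (ρ.sameCycle-sym p∼ρq))
  ... | no z≢p   | no z≢q   = subst (SameCycle ρ z) (elsewhere z z≢p z≢q) (1 , refl)

  τ-cycle⊆ρ-cycle : ∀ {x y} → SameCycle τ x y → SameCycle ρ x y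
  τ-cycle⊆ρ-cycle {x} = τ.sameCycle-closed (SameCycle ρ x)
                          (λ z x∼z → ρ.sameCycle-trans x∼z (τ-step-within-ρ-cycle z)) ρ.sameCycle-refl

  InMerged : Fin n → Set
  InMerged z = SameCycle τ p z ⊎ SameCycle τ q z

  merged-closed : ∀ z → InMerged z → InMerged (ρ ⟨$⟩ʳ z)
  merged-closed z m with z F.≟ p | z F.≟ q
  ... | yes refl | _        = inj₂ (subst (SameCycle τ q) (sym at-p) (1 , refl))
  ... | no _     | yes refl = inj₁ (subst (SameCycle τ p) (sym at-q) (1 , refl))
  ... | no z≢p   | no z≢q   = subst InMerged (sym (elsewhere z z≢p z≢q)) (Sum.map τ.sameCycle-step τ.sameCycle-step m)

  outside-agree : ∀ {x} → ¬ InMerged x → ∀ k → iter ρ k x ≡ iter τ k x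
  outside-agree ¬m zero    = refl
  outside-agree ¬m (suc k) = trans (cong (ρ ⟨$⟩ʳ_) (outside-agree ¬m k))
    (elsewhere _ (λ e → ¬m (inj₁ (τ.sameCycle-sym (k , e)))) (λ e → ¬m (inj₂ (τ.sameCycle-sym (k , e)))))

  ρ-cycle⊆τ-cycle-outside : ∀ {x y} → ¬ InMerged x → SameCycle ρ x y → SameCycle τ x y
  ρ-cycle⊆τ-cycle-outside ¬m (k , refl) = k , sym (outside-agree ¬m k)

  module _ {mp mq} (p∼mp : SameCycle τ p mp) (least-mp : IsCycleLeast τ mp)
                   (q∼mq : SameCycle τ q mq) (least-mq : IsCycleLeast τ mq) (mp<mq : toℕ mp < toℕ mq) where

    mp-least-in-merged : ∀ y → InMerged y → toℕ mp ≤ toℕ y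
    mp-least-in-merged y (inj₁ p∼y) = least-mp y (τ.sameCycle-trans (τ.sameCycle-sym p∼mp) p∼y)
    mp-least-in-merged y (inj₂ q∼y) =
      <⇒≤ (<-≤-trans mp<mq (least-mq y (τ.sameCycle-trans (τ.sameCycle-sym q∼mq) q∼y)))

    τ-least⇒ρ-least : ∀ x → x ≢ mq → IsCycleLeast τ x → IsCycleLeast ρ x
    τ-least⇒ρ-least x x≢mq least-x with τ.sameCycle? p x | τ.sameCycle? q x
    ... | yes p∼x | _ = subst (IsCycleLeast ρ) (sym x≡mp)
          (λ y x∼y → mp-least-in-merged y (ρ.sameCycle-closed InMerged merged-closed (inj₁ p∼mp) x∼y))
      where
      x≡mp : x ≡ mp
      x≡mp = τ.cycleLeast-unique least-x least-mp (τ.sameCycle-trans (τ.sameCycle-sym p∼x) p∼mp)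
    ... | no _ | yes q∼x =
          ⊥-elim (x≢mq (τ.cycleLeast-unique least-x least-mq (τ.sameCycle-trans (τ.sameCycle-sym q∼x) q∼mq)))
    ... | no p≁x | no q≁x = λ y x∼y → least-x y (ρ-cycle⊆τ-cycle-outside [ p≁x , q≁x ] x∼y)

    cyc-merge-ordered : cyc τ ≡ suc (cyc ρ)
    cyc-merge-ordered = cyc-loses-one-minimum τ ρ mq
      (λ x x≢mq → mk⇔ (τ-least⇒ρ-least x x≢mq) (λ least-x y x∼y → least-x y (τ-cycle⊆ρ-cycle x∼y)))
      least-mq
      (λ least → <⇒≱ mp<mq (least mp mq∼mp))
      where
      mq∼mp : SameCycle ρ mq mp
      mq∼mp = ρ.sameCycle-trans (τ-cycle⊆ρ-cycle (τ.sameCycle-sym q∼mq))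
                (ρ.sameCycle-trans (ρ.sameCycle-sym p∼ρq) (τ-cycle⊆ρ-cycle p∼mp))

cyc-merge : ∀ {n} {τ ρ : Perm n} {p q} → ExchangedAt τ ρ p q → ¬ SameCycle τ p q → cyc τ ≡ suc (cyc ρ)
cyc-merge {τ = τ} {p = p} {q} ex p≁q
  with Cycles.cycleLeast-exists τ p | Cycles.cycleLeast-exists τ q
... | mp , p∼mp , least-mp | mq , q∼mq , least-mq with <-cmp (toℕ mp) (toℕ mq)
... | tri< mp<mq _ _ = Merge.cyc-merge-ordered ex p≁q p∼mp least-mp q∼mq least-mq mp<mq
... | tri> _ _ mq<mp = Merge.cyc-merge-ordered (exchangedAt-swap ex) (p≁q ∘ Cycles.sameCycle-sym τ)
                         q∼mq least-mq p∼mp least-mp mq<mp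
... | tri≈ _ mp≡mq _ = ⊥-elim (p≁q (Cycles.sameCycle-trans τ p∼mp
                         (subst (λ m → SameCycle τ m q) (sym (toℕ-injective mp≡mq)) (Cycles.sameCycle-sym τ q∼mq))))

-- The τ-path from τ(q) to its first visit to p avoids q, and ρ sends p back to τ(q): this path is
-- a ρ-cycle through p that misses q.
module Split {n} {τ ρ : Perm n} {p q : Fin n} (ex : ExchangedAt τ ρ p q) (t : ℕ)
  (path-t : iter τ t (τ ⟨$⟩ʳ q) ≡ p) (not-yet-p : ∀ {u} → u < t → iter τ u (τ ⟨$⟩ʳ q) ≢ p) where
  open ExchangedAt ex
  private
    module τ = Cycles τ

  path : ℕ → Fin n
  path u = iter τ u (τ ⟨$⟩ʳ q)

  avoids-q : ∀ {u} → u ≤ t → path u ≢ q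
  avoids-q {u} u≤t path-u with m≤n⇒m<n∨m≡n u≤t
  ... | inj₂ refl = p≢q (trans (sym path-t) path-u)
  ... | inj₁ u<t with m≤n⇒∃[o]m+o≡n u<t
  ...   | d , 1+u+d≡t = not-yet-p (subst (d <_) 1+u+d≡t (s≤s (m≤n+m d u))) (begin
    path d                               ≡⟨ cong (λ z → iter τ d (τ ⟨$⟩ʳ z)) path-u ⟨
    iter τ d (iter τ (suc u) (τ ⟨$⟩ʳ q)) ≡⟨ τ.iter-+ d (suc u) _ ⟨
    path (d + suc u)                     ≡⟨ cong path (trans (+-comm d (suc u)) 1+u+d≡t) ⟩
    path t                               ≡⟨ path-t ⟩
    p                                    ∎)
    where open ≡-Reasoning

  OnPath : Fin n → Set
  OnPath z = ∃ λ u → u ≤ t × path u ≡ z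

  path-closed : ∀ z → OnPath z → OnPath (ρ ⟨$⟩ʳ z)
  path-closed _ (u , u≤t , refl) with m≤n⇒m<n∨m≡n u≤t
  ... | inj₂ refl = 0 , z≤n , sym (trans (cong (ρ ⟨$⟩ʳ_) path-t) at-p)
  ... | inj₁ u<t  = suc u , u<t , sym (elsewhere (path u) (not-yet-p u<t) (avoids-q u≤t))

  p≁q : ¬ SameCycle ρ p q
  p≁q p∼q with Cycles.sameCycle-closed ρ OnPath path-closed (t , ≤-refl , path-t) p∼q
  ... | u , u≤t , path-u = avoids-q u≤t path-u

exchange-splits : ∀ {n} {τ ρ : Perm n} {p q} → ExchangedAt τ ρ p q → SameCycle τ p q → ¬ SameCycle ρ p q
exchange-splits {τ = τ} {p = p} {q} ex p∼q
  with Cycles.sameCycle-trans τ (Cycles.sameCycle-sym τ (1 , refl)) (Cycles.sameCycle-sym τ p∼q)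
... | s , path-s with least-witness {λ u → iter τ u (τ ⟨$⟩ʳ q) ≡ p} (λ u → iter τ u (τ ⟨$⟩ʳ q) F.≟ p) {s} path-s
...   | t , path-t , not-yet-p = Split.p≁q ex t path-t not-yet-p

exchange-cyc : ∀ {n} {τ ρ : Perm n} {p q} → ExchangedAt τ ρ p q → cyc τ ≡ suc (cyc ρ) ⊎ cyc ρ ≡ suc (cyc τ)
exchange-cyc {τ = τ} {p = p} {q} ex with Cycles.sameCycle? τ p q
... | no p≁q  = inj₁ (cyc-merge ex p≁q)
... | yes p∼q = inj₂ (cyc-merge (exchangedAt-sym ex) (exchange-splits ex p∼q))

exchange-sign : ∀ {n} {τ ρ : Perm n} {p q} → ExchangedAt τ ρ p q → -1ℤ ^ cyc ρ ≡ - (-1ℤ ^ cyc τ)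
exchange-sign {τ = τ} {ρ} ex with exchange-cyc ex
... | inj₂ ρ≡1+τ = trans (cong (-1ℤ ^_) ρ≡1+τ) (-1*i≡-i _)
... | inj₁ τ≡1+ρ = begin
  -1ℤ ^ cyc ρ                  ≡⟨ neg-involutive _ ⟨
  - - (-1ℤ ^ cyc ρ)            ≡⟨ cong -_ (-1*i≡-i _) ⟨
  - (-1ℤ ^ suc (cyc ρ))        ≡⟨ cong (λ c → - (-1ℤ ^ c)) τ≡1+ρ ⟨
  - (-1ℤ ^ cyc τ)              ∎
  where open ≡-Reasoning

ShiftsBelow : ∀ {n} → Perm n → ℕ → Set
ShiftsBelow σ k = ∀ x → toℕ x < k → toℕ (σ ⟨$⟩ʳ x) ≡ suc (toℕ x)

module _ {n} (σ : Perm n) {k : ℕ} where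

  shifted-preimage : ShiftsBelow σ k → ∀ {y t} → t < k → toℕ (σ ⟨$⟩ʳ y) ≡ suc t → toℕ y ≡ t
  shifted-preimage shifts {y} {t} t<k σy≡1+t = trans (cong toℕ (sym x≡y)) toℕ-x
    where
    t<n : t < n
    t<n = <-trans (n<1+n t) (subst (_< n) σy≡1+t (toℕ<n (σ ⟨$⟩ʳ y)))
    x : Fin n
    x = fromℕ< t<n
    toℕ-x : toℕ x ≡ t
    toℕ-x = toℕ-fromℕ< t<n
    x≡y : x ≡ y
    x≡y = Cycles.⟨$⟩ʳ-injective σ (toℕ-injective (begin
      toℕ (σ ⟨$⟩ʳ x) ≡⟨ shifts x (subst (_< k) (sym toℕ-x) t<k) ⟩
      suc (toℕ x)    ≡⟨ cong suc toℕ-x ⟩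
      suc t          ≡⟨ σy≡1+t ⟨
      toℕ (σ ⟨$⟩ʳ y) ∎))
      where open ≡-Reasoning

  unshifted-image : ShiftsBelow σ k → ∀ {y} → k ≤ toℕ y → toℕ (σ ⟨$⟩ʳ y) ≡ 0 ⊎ k < toℕ (σ ⟨$⟩ʳ y)
  unshifted-image shifts {y} k≤y with toℕ (σ ⟨$⟩ʳ y) in σy≡
  ... | zero  = inj₁ refl
  ... | suc t with t ℕ.<? k
  ...   | yes t<k = ⊥-elim (<⇒≱ t<k (subst (k ≤_) (shifted-preimage shifts t<k σy≡) k≤y))
  ...   | no  t≮k = inj₂ (s≤s (≮⇒≥ t≮k))

module AdjacentExchange {m} {τ ρ : Perm (suc m)} {k : Fin m}
  (ex : ExchangedAt τ ρ (inject₁ k) (F.suc k)) (shifts : ShiftsBelow ρ (toℕ k))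
  (ρp≢q : ρ ⟨$⟩ʳ inject₁ k ≢ F.suc k) (ρq≢q : ρ ⟨$⟩ʳ F.suc k ≢ F.suc k) where
  open ExchangedAt ex

  private
    p q : Fin (suc m)
    p = inject₁ k
    q = F.suc k

    p<q : toℕ p < toℕ q
    p<q = s≤s (≤-reflexive (toℕ-inject₁ k))

    above-q : ∀ {x} → toℕ k ≤ toℕ x → x ≢ p → x ≢ q → toℕ q < toℕ x
    above-q k≤x x≢p x≢q = ≤∧≢⇒< (≤∧≢⇒< k≤x (λ e → x≢p (toℕ-injective (trans (sym e) (sym (toℕ-inject₁ k))))))
                                   (λ e → x≢q (toℕ-injective (sym e)))

    below-p : ∀ {x} → toℕ x < toℕ q → x ≢ p → toℕ x < toℕ p
    below-p x<q x≢p = ≤∧≢⇒< (subst (_ ≤_) (sym (toℕ-inject₁ k)) (≤-pred x<q)) (x≢p ∘ toℕ-injective)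

    unchanged-above-q : ∀ {x} → toℕ q < toℕ x → ρ ⟨$⟩ʳ x ≡ τ ⟨$⟩ʳ x
    unchanged-above-q q<x = elsewhere _ (λ { refl → <-asym q<x p<q }) (λ { refl → <-irrefl refl q<x })

  -- The value q is taken at a position beyond q, so a right-to-left minimum at q is below q,
  -- and every value below q except the least is taken at a position before p.
  rlm-at-q-is-zero : (∀ x → toℕ q < toℕ x → toℕ (ρ ⟨$⟩ʳ q) < toℕ (ρ ⟨$⟩ʳ x)) → toℕ (ρ ⟨$⟩ʳ q) ≡ 0
  rlm-at-q-is-zero rlm with unshifted-image ρ shifts {q} (n≤1+n (toℕ k))
  ... | inj₁ ρq≡0 = ρq≡0
  ... | inj₂ k<ρq = ⊥-elim (<-asym q<ρq (subst (λ z → toℕ (ρ ⟨$⟩ʳ q) < toℕ z) ρr≡q (rlm r q<r)))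
    where
    q<ρq : toℕ q < toℕ (ρ ⟨$⟩ʳ q)
    q<ρq = ≤∧≢⇒< k<ρq (λ e → ρq≢q (toℕ-injective (sym e)))
    r : Fin (suc m)
    r = ρ ⟨$⟩ˡ q
    ρr≡q : ρ ⟨$⟩ʳ r ≡ q
    ρr≡q = inverseʳ ρ
    k≤r : toℕ k ≤ toℕ r
    k≤r with toℕ r ℕ.<? toℕ k
    ... | no  r≮k = ≮⇒≥ r≮k
    ... | yes r<k = ⊥-elim (<-irrefl (trans (sym (shifts r r<k)) (cong toℕ ρr≡q)) (s≤s r<k))
    q<r : toℕ q < toℕ r
    q<r = above-q k≤r (λ r≡p → ρp≢q (trans (cong (ρ ⟨$⟩ʳ_) (sym r≡p)) ρr≡q))
                      (λ r≡q → ρq≢q (trans (cong (ρ ⟨$⟩ʳ_) (sym r≡q)) ρr≡q))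

  RLMv⊆ : ∀ v → InRLMv ρ v → InRLMv τ v
  RLMv⊆ _ (i , refl , rlm) with i F.≟ p | i F.≟ q
  ... | yes refl | _ = q , sym at-p , λ x q<x →
          subst (λ z → toℕ (ρ ⟨$⟩ʳ i) < toℕ z) (unchanged-above-q q<x) (rlm x (<-trans p<q q<x))
  ... | no _ | yes refl = p , sym at-q , λ x p<x → after-p x p<x (x F.≟ q)
    where
    after-p : ∀ x → toℕ p < toℕ x → Dec (x ≡ q) → toℕ (ρ ⟨$⟩ʳ q) < toℕ (τ ⟨$⟩ʳ x)
    after-p x _ (yes refl) = subst (λ z → toℕ (ρ ⟨$⟩ʳ q) < toℕ z) at-p
      (subst (_< toℕ (ρ ⟨$⟩ʳ p)) (sym (rlm-at-q-is-zero rlm))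
        (n≢0⇒n>0 λ ρp≡0 → p≢q (Cycles.⟨$⟩ʳ-injective ρ (toℕ-injective
          (trans ρp≡0 (sym (rlm-at-q-is-zero rlm)))))))
    after-p x p<x (no x≢q) = subst (λ z → toℕ (ρ ⟨$⟩ʳ q) < toℕ z) (unchanged-above-q q<x) (rlm x q<x)
      where
      q<x : toℕ q < toℕ x
      q<x = above-q (<⇒≤ (subst (_< toℕ x) (toℕ-inject₁ k) p<x)) (λ { refl → <-irrefl refl p<x }) x≢q
  ... | no i≢p | no i≢q = i , sym (elsewhere i i≢p i≢q) , λ x i<x → after-i x i<x (x F.≟ p) (x F.≟ q)
    where
    after-i : ∀ x → toℕ i < toℕ x → Dec (x ≡ p) → Dec (x ≡ q) → toℕ (ρ ⟨$⟩ʳ i) < toℕ (τ ⟨$⟩ʳ x)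
    after-i x i<x (yes refl) _ = subst (λ z → toℕ (ρ ⟨$⟩ʳ i) < toℕ z) at-q (rlm q (<-trans i<x p<q))
    after-i x i<x (no _) (yes refl) = subst (λ z → toℕ (ρ ⟨$⟩ʳ i) < toℕ z) at-p (rlm p (below-p i<x i≢p))
    after-i x i<x (no x≢p) (no x≢q) = subst (λ z → toℕ (ρ ⟨$⟩ʳ i) < toℕ z) (elsewhere x x≢p x≢q) (rlm x i<x)

  EXCv⊆ : ∀ v → InEXCv ρ v → InEXCv τ v
  EXCv⊆ _ (i , refl , i<ρi) with i F.≟ p | i F.≟ q
  ... | yes refl | _ = q , sym at-p , subst (λ z → toℕ q < toℕ z) at-p
          (above-q (<⇒≤ (subst (_< toℕ (ρ ⟨$⟩ʳ p)) (toℕ-inject₁ k) i<ρi))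
                   (λ e → <-irrefl (cong toℕ (sym e)) i<ρi) ρp≢q)
  ... | no _ | yes refl = p , sym at-q , subst (λ z → toℕ p < toℕ z) at-q (<-trans p<q i<ρi)
  ... | no i≢p | no i≢q = i , sym (elsewhere i i≢p i≢q) , subst (λ z → toℕ i < toℕ z) (elsewhere i i≢p i≢q) i<ρi

firstFin-just : ∀ {m} (P : Fin m → Bool) k → firstFin P ≡ just k →
                P k ≡ true × (∀ k′ → toℕ k′ < toℕ k → P k′ ≡ false)
firstFin-just {suc m} P k found with P F.zero in P0
firstFin-just {suc m} P .F.zero refl | true = P0 , λ _ ()
... | false with firstFin (P ∘ F.suc) in found′
firstFin-just {suc m} P .(F.suc k) refl | false | just k with firstFin-just (P ∘ F.suc) k found′
... | Pk , earlier = Pk , λ { F.zero _ → P0 ; (F.suc k′) (s≤s k′<k) → earlier k′ k′<k }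

firstFin-nothing : ∀ {m} (P : Fin m → Bool) → firstFin P ≡ nothing → ∀ k → P k ≡ false
firstFin-nothing {suc m} P none k with P F.zero in P0
firstFin-nothing {suc m} P () k | true
... | false with firstFin (P ∘ F.suc) in none′
firstFin-nothing {suc m} P refl F.zero    | false | nothing = P0
firstFin-nothing {suc m} P refl (F.suc k) | false | nothing = firstFin-nothing (P ∘ F.suc) none′ k

firstFin-least : ∀ {m} (P : Fin m → Bool) k → P k ≡ true → (∀ k′ → toℕ k′ < toℕ k → P k′ ≡ false) →
                 firstFin P ≡ just k
firstFin-least {suc m} P F.zero Pk _ rewrite Pk = refl
firstFin-least {suc m} P (F.suc k) Pk earlier
  rewrite earlier F.zero (s≤s z≤n)
        | firstFin-least (P ∘ F.suc) k Pk (λ k′ k′<k → earlier (F.suc k′) (s≤s k′<k)) = refl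

not-does≡false⇔ : ∀ {P : Set} (P? : Dec P) → not (does P?) ≡ false ⇔ P
not-does≡false⇔ (yes p) = mk⇔ (λ _ → p) (λ _ → refl)
not-does≡false⇔ (no ¬p) = mk⇔ (λ ()) (λ p → ⊥-elim (¬p p))

not-does≡true⇔ : ∀ {P : Set} (P? : Dec P) → not (does P?) ≡ true ⇔ (¬ P)
not-does≡true⇔ (yes p) = mk⇔ (λ ()) (λ ¬p → ⊥-elim (¬p p))
not-does≡true⇔ (no ¬p) = mk⇔ (λ _ → ¬p) (λ _ → refl)

module _ {m} (σ : Perm (suc m)) where

  breaksAt : Fin m → Bool
  breaksAt k = not (does (toℕ (σ ⟨$⟩ʳ inject₁ k) ℕ.≟ suc (toℕ k)))

  breaksAt≡false⇔ : ∀ k → breaksAt k ≡ false ⇔ (toℕ (σ ⟨$⟩ʳ inject₁ k) ≡ suc (toℕ k))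
  breaksAt≡false⇔ k = not-does≡false⇔ (_ ℕ.≟ _)

  breaksAt≡true⇔ : ∀ k → breaksAt k ≡ true ⇔ (σ ⟨$⟩ʳ inject₁ k ≢ F.suc k)
  breaksAt≡true⇔ k = ⇔.trans (not-does≡true⇔ (_ ℕ.≟ _))
                       (mk⇔ (λ ≢1+k eq → ≢1+k (cong toℕ eq)) (λ ≢q eq → ≢q (toℕ-injective eq)))

  shiftsBelow-from-tests : ∀ {t} → t ≤ m → (∀ k′ → toℕ k′ < t → breaksAt k′ ≡ false) → ShiftsBelow σ t
  shiftsBelow-from-tests t≤m tests x x<t = begin
    toℕ (σ ⟨$⟩ʳ x)             ≡⟨ cong (toℕ ∘ (σ ⟨$⟩ʳ_)) (inject₁-lower₁ x m≢x) ⟨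
    toℕ (σ ⟨$⟩ʳ inject₁ k′)    ≡⟨ Equivalence.to (breaksAt≡false⇔ k′) (tests k′ (subst (_< _) (sym (toℕ-lower₁ x m≢x)) x<t)) ⟩
    suc (toℕ k′)               ≡⟨ cong suc (toℕ-lower₁ x m≢x) ⟩
    suc (toℕ x)                ∎
    where
    open ≡-Reasoning
    m≢x : m ≢ toℕ x
    m≢x m≡x = <⇒≱ x<t (subst (_ ≤_) m≡x t≤m)
    k′ : Fin m
    k′ = lower₁ x m≢x

  tests-from-shiftsBelow : ∀ {t} → ShiftsBelow σ t → ∀ k′ → toℕ k′ < t → breaksAt k′ ≡ false
  tests-from-shiftsBelow shifts k′ k′<t = Equivalence.from (breaksAt≡false⇔ k′)
    (trans (shifts (inject₁ k′) (subst (_< _) (sym (toℕ-inject₁ k′)) k′<t)) (cong suc (toℕ-inject₁ k′)))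

  iσ-just : ∀ {k} → iσ σ ≡ just k → ShiftsBelow σ (toℕ k) × σ ⟨$⟩ʳ inject₁ k ≢ F.suc k
  iσ-just {k} found with firstFin-just breaksAt k found
  ... | breaks , earlier = shiftsBelow-from-tests (<⇒≤ (toℕ<n k)) earlier , Equivalence.to (breaksAt≡true⇔ k) breaks

  iσ-nothing : iσ σ ≡ nothing → ShiftsBelow σ m
  iσ-nothing none = shiftsBelow-from-tests ≤-refl (λ k′ _ → firstFin-nothing breaksAt none k′)

  iσ-least : ∀ {k} → ShiftsBelow σ (toℕ k) → σ ⟨$⟩ʳ inject₁ k ≢ F.suc k → iσ σ ≡ just k
  iσ-least {k} shifts σp≢q =
    firstFin-least breaksAt k (Equivalence.from (breaksAt≡true⇔ k) σp≢q) (tests-from-shiftsBelow shifts)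

transpose-exchanges : ∀ {n} {τ ρ : Perm n} {p q} → p ≢ q →
                      (∀ x → ρ ⟨$⟩ʳ x ≡ τ ⟨$⟩ʳ PC.transpose p q x) → ExchangedAt τ ρ p q
transpose-exchanges {τ = τ} {ρ} {p} {q} p≢q ρ≡τ∘t = record
  { p≢q       = p≢q
  ; at-p      = trans (ρ≡τ∘t p) (cong (τ ⟨$⟩ʳ_) t[p])
  ; at-q      = trans (ρ≡τ∘t q) (cong (τ ⟨$⟩ʳ_) t[q])
  ; elsewhere = λ x x≢p x≢q → trans (ρ≡τ∘t x) (cong (τ ⟨$⟩ʳ_) (t[x] x x≢p x≢q))
  }
  where
  t[p] : PC.transpose p q p ≡ q
  t[p] rewrite dec-true (p F.≟ p) refl = refl
  t[q] : PC.transpose p q q ≡ p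
  t[q] rewrite dec-false (q F.≟ p) (p≢q ∘ sym) | dec-true (q F.≟ q) refl = refl
  t[x] : ∀ x → x ≢ p → x ≢ q → PC.transpose p q x ≡ x
  t[x] x x≢p x≢q rewrite dec-false (x F.≟ p) x≢p | dec-false (x F.≟ q) x≢q = refl

φ-exchanges : ∀ {m} {σ : Perm (suc m)} {k} → iσ σ ≡ just k → ExchangedAt σ (φ σ) (inject₁ k) (F.suc k)
φ-exchanges {σ = σ} {k} found = transpose-exchanges inject₁≢suc (φ-transposes found)
  where
  inject₁≢suc : inject₁ k ≢ F.suc k
  inject₁≢suc eq = 1+n≢n (sym (trans (sym (toℕ-inject₁ k)) (cong toℕ eq)))
  φ-transposes : iσ σ ≡ just k → ∀ x → φ σ ⟨$⟩ʳ x ≡ σ ⟨$⟩ʳ PC.transpose (inject₁ k) (F.suc k) x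
  φ-transposes found x with iσ σ
  φ-transposes refl x | .(just k) = refl

module Involution {m j} {σ : Perm (suc m)} {k : Fin m} (σ∈E : E (suc m) j σ) (found : iσ σ ≡ just k) where
  private
    p q last : Fin (suc m)
    p    = inject₁ k
    q    = F.suc k
    last = F.fromℕ m
    ρ : Perm (suc m)
    ρ = φ σ

    σ-derangement : IsDerangement σ
    σ-derangement = proj₁ (proj₁ σ∈E)
    σ[n]≡j : ValAt σ (suc m) j
    σ[n]≡j = proj₂ (proj₁ σ∈E)
    σ∉U : ¬ U (suc m) j σ
    σ∉U = proj₂ σ∈E

    shifts : ShiftsBelow σ (toℕ k)
    shifts = proj₁ (iσ-just σ found)
    σp≢q : σ ⟨$⟩ʳ p ≢ q
    σp≢q = proj₂ (iσ-just σ found)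

    ex : ExchangedAt σ ρ p q
    ex = φ-exchanges found
    open ExchangedAt ex

    toℕ-p : toℕ p ≡ toℕ k
    toℕ-p = toℕ-inject₁ k

    p<m : toℕ p < m
    p<m = subst (_< m) (sym toℕ-p) (toℕ<n k)

  ρp≢q : ρ ⟨$⟩ʳ p ≢ q
  ρp≢q = σ-derangement q ∘ trans (sym at-p)

  ρq≢q : ρ ⟨$⟩ʳ q ≢ q
  ρq≢q = σp≢q ∘ trans (sym at-q)

  ρ-shifts : ShiftsBelow ρ (toℕ k)
  ρ-shifts x x<k = trans (cong toℕ (elsewhere x x≢p x≢q)) (shifts x x<k)
    where
    x≢p : x ≢ p
    x≢p refl = <-irrefl toℕ-p x<k
    x≢q : x ≢ q
    x≢q refl = <-asym (n<1+n (toℕ k)) x<k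

  q<m : toℕ q < m
  q<m with m≤n⇒m<n∨m≡n (toℕ<n k)
  ... | inj₁ q<m = q<m
  ... | inj₂ q≡m = ⊥-elim (p≢q (Cycles.⟨$⟩ʳ-injective σ (toℕ-injective
          (trans (sent-to-zero p (≤-reflexive (sym toℕ-p)) σp≢q)
                 (sym (sent-to-zero q (n≤1+n (toℕ k)) (σ-derangement q)))))))
    where
    sent-to-zero : ∀ y → toℕ k ≤ toℕ y → σ ⟨$⟩ʳ y ≢ q → toℕ (σ ⟨$⟩ʳ y) ≡ 0
    sent-to-zero y k≤y σy≢q with unshifted-image σ shifts k≤y
    ... | inj₁ σy≡0 = σy≡0
    ... | inj₂ k<σy = ⊥-elim (<⇒≱ (subst (_< toℕ (σ ⟨$⟩ʳ y)) q≡m q<σy) (≤-pred (toℕ<n (σ ⟨$⟩ʳ y))))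
      where
      q<σy : toℕ q < toℕ (σ ⟨$⟩ʳ y)
      q<σy = ≤∧≢⇒< k<σy (λ e → σy≢q (toℕ-injective (sym e)))

  σq≢p : σ ⟨$⟩ʳ q ≢ p
  σq≢p σq≡p with toℕ k in k≡
  ... | suc t = <-irrefl (sym 2+t≡t) (<-trans (n<1+n t) (n<1+n (suc t)))
    where
    2+t≡t : suc (suc t) ≡ t
    2+t≡t = trans (cong suc (sym k≡)) (shifted-preimage σ shifts (subst (t <_) (sym k≡) (n<1+n t))
              (trans (cong toℕ σq≡p) (trans toℕ-p k≡)))
  -- i_σ = 1 and σ(2) = 1 is exactly the case σ ∈ U_{n,j} excluded from E_{n,j}.
  ... | zero  = σ∉U (inj₂ (2≤j , (σ-derangement , σ[n]≡j) , σ[2]≡1 , σ[1]≢2))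
    where
    σq≡0 : toℕ (σ ⟨$⟩ʳ q) ≡ 0
    σq≡0 = trans (cong toℕ σq≡p) (trans toℕ-p k≡)
    σ[last]≢0 : toℕ (σ ⟨$⟩ʳ last) ≢ 0
    σ[last]≢0 e = <-irrefl (trans (cong toℕ (Cycles.⟨$⟩ʳ-injective σ (toℕ-injective (trans σq≡0 (sym e)))))
                                  (toℕ-fromℕ m)) q<m
    2≤j : 2 ≤ j
    2≤j = subst (2 ≤_) (σ[n]≡j last (cong suc (toℕ-fromℕ m))) (s≤s (n≢0⇒n>0 σ[last]≢0))
    σ[2]≡1 : ValAt σ 2 1
    σ[2]≡1 i val-i≡2 = cong suc (trans (cong (toℕ ∘ (σ ⟨$⟩ʳ_)) i≡q) σq≡0)
      where
      i≡q : i ≡ q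
      i≡q = toℕ-injective (trans (suc-injective val-i≡2) (cong suc (sym k≡)))
    σ[1]≢2 : ¬ ValAt σ 1 2
    σ[1]≢2 σ[1]≡2 = σp≢q (toℕ-injective (trans (suc-injective (σ[1]≡2 p (cong suc (trans toℕ-p k≡))))
                                               (cong suc (sym k≡))))

  ρ-derangement : IsDerangement ρ
  ρ-derangement x with x F.≟ p | x F.≟ q
  ... | yes refl | _        = σq≢p ∘ trans (sym at-p)
  ... | no _     | yes refl = ρq≢q
  ... | no x≢p   | no x≢q   = σ-derangement x ∘ trans (sym (elsewhere x x≢p x≢q))

  ρ[n]≡j : ValAt ρ (suc m) j
  ρ[n]≡j i val-i≡n = trans (cong val (elsewhere i i≢p i≢q)) (σ[n]≡j i val-i≡n)
    where
    i≢p : i ≢ p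
    i≢p refl = <-irrefl (suc-injective val-i≡n) p<m
    i≢q : i ≢ q
    i≢q refl = <-irrefl (suc-injective val-i≡n) q<m

  ρ∉U : ¬ U (suc m) j ρ
  ρ∉U (inj₁ (_ , long)) = ρp≢q (toℕ-injective (trans (suc-injective (proj₁ (long p) (s≤s p<m))) (cong suc toℕ-p)))
  ρ∉U (inj₂ (_ , _ , ρ[2]≡1 , ρ[1]≢2)) with toℕ k in k≡
  ... | zero  = σ-derangement p (toℕ-injective (begin
        toℕ (σ ⟨$⟩ʳ p) ≡⟨ cong toℕ at-q ⟨
        toℕ (ρ ⟨$⟩ʳ q) ≡⟨ suc-injective (ρ[2]≡1 q (cong (suc ∘ suc) k≡)) ⟩
        0              ≡⟨ trans toℕ-p k≡ ⟨
        toℕ p          ∎))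
    where open ≡-Reasoning
  ... | suc t = ρ[1]≢2 λ i val-i≡1 →
        cong suc (trans (ρ-shifts i (subst₂ _<_ (sym (suc-injective val-i≡1)) (sym k≡) (s≤s z≤n)))
                        (cong suc (suc-injective val-i≡1)))

  ρ∈E : E (suc m) j ρ
  ρ∈E = (ρ-derangement , ρ[n]≡j) , ρ∉U

  φ-involutive : ∀ x → φ ρ ⟨$⟩ʳ x ≡ σ ⟨$⟩ʳ x
  φ-involutive = exchangedAt-involutive ex (φ-exchanges (iσ-least ρ ρ-shifts ρp≢q))

  RLMv-preserved : ∀ v → InRLMv ρ v ⇔ InRLMv σ v
  RLMv-preserved v = mk⇔ (AdjacentExchange.RLMv⊆ ex ρ-shifts ρp≢q ρq≢q v)
                         (AdjacentExchange.RLMv⊆ (exchangedAt-sym ex) shifts σp≢q (σ-derangement q) v)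

  EXCv-preserved : ∀ v → InEXCv ρ v ⇔ InEXCv σ v
  EXCv-preserved v = mk⇔ (AdjacentExchange.EXCv⊆ ex ρ-shifts ρp≢q ρq≢q v)
                         (AdjacentExchange.EXCv⊆ (exchangedAt-sym ex) shifts σp≢q (σ-derangement q) v)

  sign-flips : -1ℤ ^ cyc ρ ≡ - (-1ℤ ^ cyc σ)
  sign-flips = exchange-sign ex

iσ-nothing⇒long-cycle : ∀ {m j} {σ : Perm (suc m)} → iσ σ ≡ nothing → ValAt σ (suc m) j → j ≡ 1 × IsLongCycle σ
iσ-nothing⇒long-cycle {m} {σ = σ} none σ[n]≡j =
  trans (sym (σ[n]≡j last (cong suc toℕ-last))) (cong suc (last-to-zero last toℕ-last)) , long
  where
  shifts : ShiftsBelow σ m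
  shifts = iσ-nothing σ none
  last : Fin (suc m)
  last = F.fromℕ m
  toℕ-last : toℕ last ≡ m
  toℕ-last = toℕ-fromℕ m
  last-to-zero : ∀ i → toℕ i ≡ m → toℕ (σ ⟨$⟩ʳ i) ≡ 0
  last-to-zero i i≡m with unshifted-image σ shifts (≤-reflexive (sym i≡m))
  ... | inj₁ σi≡0 = σi≡0
  ... | inj₂ m<σi = ⊥-elim (<⇒≱ m<σi (≤-pred (toℕ<n (σ ⟨$⟩ʳ i))))
  long : IsLongCycle σ
  long i = (λ i<n → cong suc (shifts i (≤-pred i<n))) , (λ i≡n → cong suc (last-to-zero i (suc-injective i≡n)))

E⇒iσ-defined : ∀ {m j} {σ : Perm (suc m)} → E (suc m) j σ → ∃ λ k → iσ σ ≡ just k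
E⇒iσ-defined {j = j} {σ} σ∈E with iσ σ in found
... | just k  = k , refl
... | nothing = ⊥-elim (proj₂ σ∈E (inj₁ (iσ-nothing⇒long-cycle {j = j} {σ} found (proj₂ (proj₁ σ∈E)))))

lemma2p1 : (n : ℕ) → 3 ≤ n → (j : ℕ) → 1 ≤ j → j < n →
           (σ : Perm n) → E n j σ →
           E n j (φ σ)
           × (∀ i → φ (φ σ) ⟨$⟩ʳ i ≡ σ ⟨$⟩ʳ i)
           × (∀ v → InRLMv (φ σ) v ⇔ InRLMv σ v)
           × (∀ v → InEXCv (φ σ) v ⇔ InEXCv σ v)
           × (-1ℤ ^ cyc (φ σ) ≡ - (-1ℤ ^ cyc σ))
lemma2p1 (suc m) _ j _ _ σ σ∈E with E⇒iσ-defined {j = j} {σ} σ∈E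
... | k , found = ρ∈E , φ-involutive , RLMv-preserved , EXCv-preserved , sign-flips
  where open Involution σ∈E found
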